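{- Let $F$ be a quadratic APN function on $\mathbb{F}_{2^n}$ and $L$ an $\mathbb{F}_2$-linear mapping on $\mathbb{F}_{2^n}$. Let $e_0\in\mathbb{F}_{2^n}$ with $\mathrm{Tr}(e_0)=1$, and let $T_0=\{x\in\mathbb{F}_{2^n}:\mathrm{Tr}(x)=0\}$. Then the mapping $G(x)=F(x)+\mathrm{Tr}(x)L(x)$, $x\in\mathbb{F}_{2^n}$, is a quadratic APN function on $\mathbb{F}_{2^n}$ if and only if, for every $a\in T_0$, the mapping $L_a\colon T_0\to\mathbb{F}_{2^n}$, $L_a(x)=L(x)+B_F(x,a+e_0)$, is one-to-one (equivalently, for every $a\in T_0$, $L_a(x)=0$ with $x\in T_0$ implies $x=0$).
   Context: $\mathrm{Tr}$ denotes the absolute trace $\mathbb{F}_{2^n}\to\mathbb{F}_2$. For $F\colon\mathbb{F}_{2^n}\to\mathbb{F}_{2^n}$, $B_F(x,t):=F(x+t)+F(x)+F(t)+F(0)$; $F$ is quadratic if $B_F$ is $\mathbb{F}_2$-bilinear. $F$ is APN if for all nonzero $a$ and all $b$ the equation $F(x+a)+F(x)=b$ has at most $2$ solutions in $\mathbb{F}_{2^n}$. -}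

module Defs where

open import Level using (0ℓ)
open import Data.Nat using (ℕ; zero; suc; _^_; _≤_)
open import Data.Fin using (Fin)
open import Data.List using (List; map; filter; length; allFin)
open import Data.Product using (∃; _×_)
open import Relation.Nullary using (¬_)
open import Relation.Binary.Definitions using (DecidableEquality)
open import Relation.Binary.PropositionalEquality using (_≡_)
open import Algebra.Structures using (IsCommutativeRing)
open import Function.Bundles using (_↔_; Inverse)

-- A (model of the) finite field F_{2^n}: a field of characteristic 2 with
-- exactly 2^n elements (unique up to isomorphism), with propositional equality.
record GF2^ (n : ℕ) : Set₁ where
  infixl 6 _+_
  infixl 7 _*_
  field
    Carrier : Set
    _+_ _*_ : Carrier → Carrier → Carrier
    -_ : Carrier → Carrier
    0# 1# : Carrier
    isCommutativeRing : IsCommutativeRing _≡_ _+_ _*_ -_ 0# 1#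
    0≢1 : ¬ (0# ≡ 1#)
    inverse : ∀ x → ¬ (x ≡ 0#) → ∃ λ y → x * y ≡ 1#
    char2 : 1# + 1# ≡ 0#
    _≟_ : DecidableEquality Carrier
    enum : Carrier ↔ Fin (2 ^ n)

  elements : List Carrier
  elements = map (Inverse.from enum) (allFin (2 ^ n))

  -- absolute trace Tr(x) = x + x^2 + x^4 + ... + x^(2^(n-1))
  traceAux : ℕ → Carrier → Carrier
  traceAux zero    x = 0#
  traceAux (suc k) x = x + traceAux k (x * x)

  Tr : Carrier → Carrier
  Tr = traceAux n

  B : (Carrier → Carrier) → Carrier → Carrier → Carrier
  B F x t = F (x + t) + F x + F t + F 0#

  -- F_2-linear = additive (scalars are only 0 and 1)
  IsLinear : (Carrier → Carrier) → Set
  IsLinear L = ∀ x y → L (x + y) ≡ L x + L y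

  IsQuadratic : (Carrier → Carrier) → Set
  IsQuadratic F =
    (∀ x y t → B F (x + y) t ≡ B F x t + B F y t) ×
    (∀ x t s → B F x (t + s) ≡ B F x t + B F x s)

  #sols : (Carrier → Carrier) → Carrier → Carrier → ℕ
  #sols F a b = length (filter (λ x → (F (x + a) + F x) ≟ b) elements)

  IsAPN : (Carrier → Carrier) → Set
  IsAPN F = ∀ a b → ¬ (a ≡ 0#) → #sols F a b ≤ 2

  switch : (Carrier → Carrier) → (Carrier → Carrier) → Carrier → Carrier
  switch F L x = F x + Tr x * L x

  La : (Carrier → Carrier) → (Carrier → Carrier) → Carrier → Carrier → Carrier → Carrier
  La F L e0 a x = L x + B F x (a + e0)

{-# OPTIONS --safe #-}

-- A quadratic H is APN iff for every a ≠ 0 the kernel of the F₂-linear map B_H(·, a) is {0, a}: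
-- two solutions of H(x + a) + H(x) = b differ by an element of that kernel, and conversely 0, a
-- and every kernel element solve H(x + a) + H(x) = H(a) + H(0).
-- By Fermat, Tr(x)² + Tr(x) = x^(2^n) + x = 0, so Tr is F₂-valued, and
-- B_G(x, t) = B_F(x, t) + Tr(x) L(t) + Tr(t) L(x) is B_F(x, t) on T₀ × T₀ and L(x) + B_F(x, t) on T₀ × T₁.
-- Sorting the kernel condition for G by the traces of z and a, the case T₀ × T₀ is the APN property
-- of F, the case T₀ × T₁ is the injectivity of L_{a+e₀} on T₀, and the other two cases reduce to it by
-- the symmetry of B_G and by passing from z to z + a.

module Submission where

open import Defs
open import Level using (0ℓ)
open import Data.Nat as ℕ using (ℕ; zero; suc; _≤_; z≤n; s≤s)
open import Data.Nat.Properties using (m^n≢0)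
open import Data.Product using (_×_; _,_; proj₁; proj₂)
open import Data.Sum as Sum using (_⊎_; inj₁; inj₂; [_,_]′)
open import Data.Empty using (⊥-elim)
open import Data.List using (List; []; _∷_; length; filter)
open import Data.List.Membership.Propositional using (_∈_)
open import Data.List.Membership.Propositional.Properties using (∈-map⁺; ∈-filter⁺; ∈-filter⁻; ∈-allFin)
open import Data.List.Relation.Unary.Any using (here; there)
open import Data.List.Relation.Unary.All using (_∷_)
open import Data.List.Relation.Unary.AllPairs using (_∷_)
open import Data.List.Relation.Unary.Unique.Propositional using (Unique)
open import Data.List.Relation.Unary.Unique.Propositional.Properties using (map⁺; allFin⁺; filter⁺)
open import Relation.Binary.PropositionalEquality
open import Relation.Nullary using (yes; no)
open import Relation.Unary using (Decidable)
open import Algebra.Bundles using (CommutativeRing)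
import Algebra.Properties.CommutativeSemigroup
import Algebra.Properties.Semiring.Exp
import Algebra.Properties.CommutativeMonoid.Sum
open import Data.Fin using (Fin; zero; suc)
open import Data.Fin.Properties using (punchInᵢ≢i)
open import Data.Fin.Permutation using (Permutation)
open import Data.Vec.Functional using (removeAt; replicate)
open import Function using (_∘_)
open import Function.Bundles using (_↔_; Inverse; mk↔ₛ′; _⇔_; mk⇔; Equivalence)
open import Function.Construct.Composition using (_↔-∘_)
open import Function.Construct.Symmetry using (↔-sym)

module _ {A : Set} where

  AtMostTwo : (A → Set) → Set
  AtMostTwo P = ∀ {x y z} → P x → P y → P z → x ≡ y ⊎ x ≡ z ⊎ y ≡ z

  length≤2⇒atMostTwo : ∀ {xs : List A} → length xs ≤ 2 → AtMostTwo (_∈ xs)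
  length≤2⇒atMostTwo {_ ∷ _ ∷ _ ∷ _} (s≤s (s≤s ()))
  length≤2⇒atMostTwo _ (here refl) (here refl) _ = inj₁ refl
  length≤2⇒atMostTwo _ (there (here refl)) (there (here refl)) _ = inj₁ refl
  length≤2⇒atMostTwo _ (here refl) _ (here refl) = inj₂ (inj₁ refl)
  length≤2⇒atMostTwo _ (there (here refl)) _ (there (here refl)) = inj₂ (inj₁ refl)
  length≤2⇒atMostTwo _ _ (here refl) (here refl) = inj₂ (inj₂ refl)
  length≤2⇒atMostTwo _ _ (there (here refl)) (there (here refl)) = inj₂ (inj₂ refl)

  atMostTwo⇒length≤2 : ∀ {xs : List A} → Unique xs → AtMostTwo (_∈ xs) → length xs ≤ 2
  atMostTwo⇒length≤2 {[]} _ _ = z≤n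
  atMostTwo⇒length≤2 {_ ∷ []} _ _ = s≤s z≤n
  atMostTwo⇒length≤2 {_ ∷ _ ∷ []} _ _ = s≤s (s≤s z≤n)
  atMostTwo⇒length≤2 {_ ∷ _ ∷ _ ∷ _} ((x≢y ∷ x≢z ∷ _) ∷ (y≢z ∷ _) ∷ _) two =
    ⊥-elim ([ x≢y , [ x≢z , y≢z ]′ ]′ (two (here refl) (there (here refl)) (there (there (here refl)))))

module _ {n : ℕ} (K : GF2^ n) where
  open GF2^ K

  ring : CommutativeRing 0ℓ 0ℓ
  ring = record { isCommutativeRing = isCommutativeRing }

  open CommutativeRing ring
    using (+-assoc; +-comm; +-identityˡ; +-identityʳ; *-comm; *-assoc; *-identityˡ; *-identityʳ;
           distribˡ; distribʳ; zeroˡ; zeroʳ; +-commutativeSemigroup; *-commutativeMonoid; semiring)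
  open Algebra.Properties.CommutativeSemigroup +-commutativeSemigroup using (interchange; xy∙z≈xz∙y)
  open Algebra.Properties.Semiring.Exp semiring using (_^_; ^-assocʳ)
  open ≡-Reasoning

  x+x≡0 : ∀ x → x + x ≡ 0#
  x+x≡0 x = begin
    x + x               ≡⟨ cong₂ _+_ (*-identityʳ x) (*-identityʳ x) ⟨
    x * 1# + x * 1#     ≡⟨ distribˡ x 1# 1# ⟨
    x * (1# + 1#)       ≡⟨ cong (x *_) char2 ⟩
    x * 0#              ≡⟨ zeroʳ x ⟩
    0#                  ∎

  x+[x+y]≡y : ∀ x y → x + (x + y) ≡ y
  x+[x+y]≡y x y = begin
    x + (x + y) ≡⟨ +-assoc x x y ⟨
    x + x + y   ≡⟨ cong (_+ y) (x+x≡0 x) ⟩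
    0# + y      ≡⟨ +-identityˡ y ⟩
    y           ∎

  x+y+y≡x : ∀ x y → x + y + y ≡ x
  x+y+y≡x x y = begin
    x + y + y     ≡⟨ +-assoc x y y ⟩
    x + (y + y)   ≡⟨ cong (x +_) (x+x≡0 y) ⟩
    x + 0#        ≡⟨ +-identityʳ x ⟩
    x             ∎

  x+y≡0⇒x≡y : ∀ {x y} → x + y ≡ 0# → x ≡ y
  x+y≡0⇒x≡y {x} {y} x+y≡0 = begin
    x           ≡⟨ x+y+y≡x x y ⟨
    x + y + y   ≡⟨ cong (_+ y) x+y≡0 ⟩
    0# + y      ≡⟨ +-identityˡ y ⟩
    y           ∎

  x+y≡x+z⇒y≡z : ∀ {x y z} → x + y ≡ x + z → y ≡ z
  x+y≡x+z⇒y≡z {x} {y} {z} eq = trans (sym (x+[x+y]≡y x y)) (trans (cong (x +_) eq) (x+[x+y]≡y x z))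

  [x+y]²≡x²+y² : ∀ x y → (x + y) * (x + y) ≡ x * x + y * y
  [x+y]²≡x²+y² x y = begin
    (x + y) * (x + y)                       ≡⟨ distribʳ (x + y) x y ⟩
    x * (x + y) + y * (x + y)               ≡⟨ cong₂ _+_ (distribˡ x x y) (distribˡ y x y) ⟩
    (x * x + x * y) + (y * x + y * y)       ≡⟨ interchange (x * x) (x * y) (y * x) (y * y) ⟩
    (x * x + y * x) + (x * y + y * y)       ≡⟨ cong (λ u → (x * x + u) + (x * y + y * y)) (*-comm y x) ⟩
    (x * x + x * y) + (x * y + y * y)       ≡⟨ +-assoc (x * x) (x * y) (x * y + y * y) ⟩
    x * x + (x * y + (x * y + y * y))       ≡⟨ cong (x * x +_) (x+[x+y]≡y (x * y) (y * y)) ⟩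
    x * x + y * y                           ∎

  x*y≡0⇒x≡0⊎y≡0 : ∀ {x y} → x * y ≡ 0# → x ≡ 0# ⊎ y ≡ 0#
  x*y≡0⇒x≡0⊎y≡0 {x} {y} xy≡0 with x ≟ 0#
  ... | yes x≡0 = inj₁ x≡0
  ... | no x≢0 with inverse x x≢0
  ...   | x⁻¹ , xx⁻¹≡1 = inj₂ (begin
    y               ≡⟨ *-identityˡ y ⟨
    1# * y          ≡⟨ cong (_* y) (trans (*-comm x⁻¹ x) xx⁻¹≡1) ⟨
    (x⁻¹ * x) * y   ≡⟨ *-assoc x⁻¹ x y ⟩
    x⁻¹ * (x * y)   ≡⟨ cong (x⁻¹ *_) xy≡0 ⟩
    x⁻¹ * 0#        ≡⟨ zeroʳ x⁻¹ ⟩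
    0#              ∎)

  x*x+x≡0⇒x≡0⊎x≡1 : ∀ {x} → x * x + x ≡ 0# → x ≡ 0# ⊎ x ≡ 1#
  x*x+x≡0⇒x≡0⊎x≡1 {x} x*x+x≡0 = Sum.map₂ x+y≡0⇒x≡y (x*y≡0⇒x≡0⊎y≡0 (begin
    x * (x + 1#)      ≡⟨ distribˡ x x 1# ⟩
    x * x + x * 1#    ≡⟨ cong (x * x +_) (*-identityʳ x) ⟩
    x * x + x         ≡⟨ x*x+x≡0 ⟩
    0#                ∎))

  *-cancelʳ : ∀ {x y z} → z ≢ 0# → x * z ≡ y * z → x ≡ y
  *-cancelʳ {x} {y} {z} z≢0 xz≡yz = [ x+y≡0⇒x≡y , ⊥-elim ∘ z≢0 ]′ (x*y≡0⇒x≡0⊎y≡0 (begin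
    (x + y) * z       ≡⟨ distribʳ z x y ⟩
    x * z + y * z     ≡⟨ cong (_+ y * z) xz≡yz ⟩
    y * z + y * z     ≡⟨ x+x≡0 (y * z) ⟩
    0#                ∎))

  open Algebra.Properties.CommutativeMonoid.Sum *-commutativeMonoid using ()
    renaming (sum to product; sum-remove to product-remove; ∑-distrib-+ to product-distrib-*;
              sum-permute to product-permute; sum-cong-≗ to product-cong;
              sum-replicate to product-replicate; sum-replicate-zero to product-replicate-1)

  product-single : ∀ {m} (f : Fin m → Carrier) i → (∀ j → j ≢ i → f j ≡ 1#) → product f ≡ f i
  product-single {suc m} f i others≡1 = begin
    product f                     ≡⟨ product-remove {i = i} f ⟩
    f i * product (removeAt f i)  ≡⟨ cong (f i *_) (product-cong (λ j → others≡1 _ (punchInᵢ≢i i j))) ⟩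
    f i * product (replicate m 1#) ≡⟨ cong (f i *_) (product-replicate-1 m) ⟩
    f i * 1#                      ≡⟨ *-identityʳ (f i) ⟩
    f i                           ∎

  product-nonzero : ∀ {m} (f : Fin m → Carrier) → (∀ i → f i ≢ 0#) → product f ≢ 0#
  product-nonzero {zero} f _ 1≡0 = 0≢1 (sym 1≡0)
  product-nonzero {suc m} f f≢0 f₀*rest≡0 =
    [ f≢0 zero , product-nonzero (f ∘ suc) (f≢0 ∘ suc) ]′ (x*y≡0⇒x≡0⊎y≡0 f₀*rest≡0)

  q : ℕ
  q = 2 ℕ.^ n

  ∏ : (Carrier → Carrier) → Carrier
  ∏ f = product (f ∘ Inverse.from enum)

  ∏-cong : ∀ {f g} → (∀ y → f y ≡ g y) → ∏ f ≡ ∏ g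
  ∏-cong f≗g = product-cong (f≗g ∘ Inverse.from enum)

  ∏-distrib-* : ∀ f g → ∏ (λ y → f y * g y) ≡ ∏ f * ∏ g
  ∏-distrib-* f g = product-distrib-* (f ∘ Inverse.from enum) (g ∘ Inverse.from enum)

  ∏-const : ∀ x → ∏ (λ _ → x) ≡ x ^ q
  ∏-const x = product-replicate q

  ∏-reindex : ∀ (σ : Carrier ↔ Carrier) f → ∏ f ≡ ∏ (f ∘ Inverse.to σ)
  ∏-reindex σ f = begin
    ∏ f                                   ≡⟨ product-permute (f ∘ from) π ⟩
    product (f ∘ from ∘ to ∘ σ.to ∘ from) ≡⟨ product-cong (λ i → cong f (strictlyInverseʳ (σ.to (from i)))) ⟩
    ∏ (f ∘ σ.to)                          ∎
    where
    open Inverse enum using (to; from; strictlyInverseʳ)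
    module σ = Inverse σ
    π : Permutation q q
    π = enum ↔-∘ (σ ↔-∘ ↔-sym enum)

  ∏-single : ∀ f z → (∀ y → y ≢ z → f y ≡ 1#) → ∏ f ≡ f z
  ∏-single f z others≡1 = begin
    ∏ f                             ≡⟨ product-single (f ∘ from) (to z) others≡1ᶠ ⟩
    f (from (to z))                 ≡⟨ cong f (strictlyInverseʳ z) ⟩
    f z                             ∎
    where
    open Inverse enum using (to; from; strictlyInverseˡ; strictlyInverseʳ)
    others≡1ᶠ : ∀ i → i ≢ to z → f (from i) ≡ 1#
    others≡1ᶠ i i≢z = others≡1 (from i) (λ from-i≡z → i≢z (trans (sym (strictlyInverseˡ i)) (cong to from-i≡z)))

  ∏-nonzero : ∀ f → (∀ y → f y ≢ 0#) → ∏ f ≢ 0#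
  ∏-nonzero f f≢0 = product-nonzero (f ∘ Inverse.from enum) (f≢0 ∘ Inverse.from enum)

  0^m≡0 : ∀ m .{{_ : ℕ.NonZero m}} → 0# ^ m ≡ 0#
  0^m≡0 (suc m) = zeroˡ (0# ^ m)

  scaling : ∀ {x} → x ≢ 0# → Carrier ↔ Carrier
  scaling {x} x≢0 with inverse x x≢0
  ... | x⁻¹ , xx⁻¹≡1 = mk↔ₛ′ (x *_) (x⁻¹ *_) (cancel x x⁻¹ xx⁻¹≡1) (cancel x⁻¹ x (trans (*-comm x⁻¹ x) xx⁻¹≡1))
    where
    cancel : ∀ u v → u * v ≡ 1# → ∀ y → u * (v * y) ≡ y
    cancel u v uv≡1 y = trans (sym (*-assoc u v y)) (trans (cong (_* y) uv≡1) (*-identityˡ y))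

  -- Multiplication by x ≠ 0 permutes the field. nz replaces the factor 0 by 1 so that ∏ nz ≠ 0,
  -- and δ corrects the one factor, at y = 0, where x · nz y and nz (x y) differ.
  x^q≡x : ∀ x → x ^ q ≡ x
  x^q≡x x with x ≟ 0#
  ... | yes refl = 0^m≡0 q {{m^n≢0 2 n}}
  ... | no x≢0 = *-cancelʳ (∏-nonzero nz nz≢0) (begin
    x ^ q * ∏ nz                  ≡⟨ cong (_* ∏ nz) (∏-const x) ⟨
    ∏ (λ _ → x) * ∏ nz            ≡⟨ ∏-distrib-* (λ _ → x) nz ⟨
    ∏ (λ y → x * nz y)            ≡⟨ ∏-cong x*nz≡nz[x*]*δ ⟩
    ∏ (λ y → nz (x * y) * δ y)    ≡⟨ ∏-distrib-* (nz ∘ (x *_)) δ ⟩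
    ∏ (nz ∘ (x *_)) * ∏ δ         ≡⟨ cong₂ _*_ (sym (∏-reindex (scaling x≢0) nz)) (∏-single δ 0# δ-others) ⟩
    ∏ nz * δ 0#                   ≡⟨ cong (∏ nz *_) δ-0 ⟩
    ∏ nz * x                      ≡⟨ *-comm (∏ nz) x ⟩
    x * ∏ nz                      ∎)
    where
    nz δ : Carrier → Carrier
    nz y with y ≟ 0#
    ... | yes _ = 1#
    ... | no _ = y
    δ y with y ≟ 0#
    ... | yes _ = x
    ... | no _ = 1#

    nz≢0 : ∀ y → nz y ≢ 0#
    nz≢0 y with y ≟ 0#
    ... | yes _ = λ 1≡0 → 0≢1 (sym 1≡0)
    ... | no y≢0 = y≢0

    δ-0 : δ 0# ≡ x
    δ-0 with 0# ≟ 0#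
    ... | yes _ = refl
    ... | no 0≢0 = ⊥-elim (0≢0 refl)

    δ-others : ∀ y → y ≢ 0# → δ y ≡ 1#
    δ-others y y≢0 with y ≟ 0#
    ... | yes y≡0 = ⊥-elim (y≢0 y≡0)
    ... | no _ = refl

    x*nz≡nz[x*]*δ : ∀ y → x * nz y ≡ nz (x * y) * δ y
    x*nz≡nz[x*]*δ y with y ≟ 0# | (x * y) ≟ 0#
    ... | yes _   | yes _     = trans (*-identityʳ x) (sym (*-identityˡ x))
    ... | yes y≡0 | no xy≢0   = ⊥-elim (xy≢0 (trans (cong (x *_) y≡0) (zeroʳ x)))
    ... | no y≢0  | yes xy≡0  = ⊥-elim ([ x≢0 , y≢0 ]′ (x*y≡0⇒x≡0⊎y≡0 xy≡0))
    ... | no _    | no _      = sym (*-identityʳ (x * y))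

  linear⇒0↦0 : ∀ {f} → IsLinear f → f 0# ≡ 0#
  linear⇒0↦0 {f} f-linear = begin
    f 0#            ≡⟨ cong f (+-identityʳ 0#) ⟨
    f (0# + 0#)     ≡⟨ f-linear 0# 0# ⟩
    f 0# + f 0#     ≡⟨ x+x≡0 (f 0#) ⟩
    0#              ∎

  traceAux-linear : ∀ k → IsLinear (traceAux k)
  traceAux-linear zero x y = sym (+-identityˡ 0#)
  traceAux-linear (suc k) x y = begin
    (x + y) + traceAux k ((x + y) * (x + y))            ≡⟨ cong (λ z → (x + y) + traceAux k z) ([x+y]²≡x²+y² x y) ⟩
    (x + y) + traceAux k (x * x + y * y)                ≡⟨ cong ((x + y) +_) (traceAux-linear k (x * x) (y * y)) ⟩
    (x + y) + (traceAux k (x * x) + traceAux k (y * y)) ≡⟨ interchange x y _ _ ⟩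
    (x + traceAux k (x * x)) + (y + traceAux k (y * y)) ∎

  Tr-linear : IsLinear Tr
  Tr-linear = traceAux-linear n

  traceAux-square : ∀ k x → traceAux k x * traceAux k x + traceAux k x ≡ x ^ (2 ℕ.^ k) + x
  traceAux-square zero x = begin
    0# * 0# + 0#    ≡⟨ cong (_+ 0#) (zeroˡ 0#) ⟩
    0# + 0#         ≡⟨ x+x≡0 0# ⟩
    0#              ≡⟨ x+x≡0 x ⟨
    x + x           ≡⟨ cong (_+ x) (*-identityʳ x) ⟨
    x * 1# + x      ∎
  traceAux-square (suc k) x = begin
    (x + t) * (x + t) + (x + t)             ≡⟨ cong (_+ (x + t)) ([x+y]²≡x²+y² x t) ⟩
    (x * x + t * t) + (x + t)               ≡⟨ interchange (x * x) (t * t) x t ⟩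
    (x * x + x) + (t * t + t)               ≡⟨ cong ((x * x + x) +_) (traceAux-square k (x * x)) ⟩
    (x * x + x) + ((x * x) ^ 2ᵏ + x * x)    ≡⟨ +-comm (x * x + x) _ ⟩
    ((x * x) ^ 2ᵏ + x * x) + (x * x + x)    ≡⟨ +-assoc ((x * x) ^ 2ᵏ) (x * x) (x * x + x) ⟩
    (x * x) ^ 2ᵏ + (x * x + (x * x + x))    ≡⟨ cong ((x * x) ^ 2ᵏ +_) (x+[x+y]≡y (x * x) x) ⟩
    (x * x) ^ 2ᵏ + x                        ≡⟨ cong (λ y → (x * y) ^ 2ᵏ + x) (*-identityʳ x) ⟨
    (x ^ 2) ^ 2ᵏ + x                        ≡⟨ cong (_+ x) (^-assocʳ x 2 2ᵏ) ⟩
    x ^ (2 ℕ.^ suc k) + x                   ∎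
    where
    t : Carrier
    t = traceAux k (x * x)
    2ᵏ : ℕ
    2ᵏ = 2 ℕ.^ k

  Tr≡0⊎Tr≡1 : ∀ x → Tr x ≡ 0# ⊎ Tr x ≡ 1#
  Tr≡0⊎Tr≡1 x = x*x+x≡0⇒x≡0⊎x≡1 (begin
    Tr x * Tr x + Tr x    ≡⟨ traceAux-square n x ⟩
    x ^ q + x             ≡⟨ cong (_+ x) (x^q≡x x) ⟩
    x + x                 ≡⟨ x+x≡0 x ⟩
    0#                    ∎)

  Tr-0 : Tr 0# ≡ 0#
  Tr-0 = linear⇒0↦0 Tr-linear

  Tr-+ : ∀ {x y u v} → Tr x ≡ u → Tr y ≡ v → Tr (x + y) ≡ u + v
  Tr-+ {x} {y} Tr-x Tr-y = trans (Tr-linear x y) (cong₂ _+_ Tr-x Tr-y)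

  T₀≢T₁ : ∀ {x y} → Tr x ≡ 0# → Tr y ≡ 1# → x ≢ y
  T₀≢T₁ Tr-x Tr-y x≡y = 0≢1 (trans (sym Tr-x) (trans (cong Tr x≡y) Tr-y))

  elements-complete : ∀ x → x ∈ elements
  elements-complete x = subst (_∈ elements) (strictlyInverseʳ x) (∈-map⁺ from (∈-allFin (to x)))
    where open Inverse enum using (to; from; strictlyInverseʳ)

  elements-unique : Unique elements
  elements-unique = map⁺ from-injective (allFin⁺ q)
    where
    open Inverse enum using (to; from; strictlyInverseˡ)
    from-injective : ∀ {i j} → from i ≡ from j → i ≡ j
    from-injective {i} {j} eq = trans (sym (strictlyInverseˡ i)) (trans (cong to eq) (strictlyInverseˡ j))

  #sols≤2⇔atMostTwo : ∀ H a b → #sols H a b ≤ 2 ⇔ AtMostTwo (λ x → H (x + a) + H x ≡ b)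
  #sols≤2⇔atMostTwo H a b = mk⇔ length≤2⇒two two⇒length≤2
    where
    Solves : Carrier → Set
    Solves x = H (x + a) + H x ≡ b

    P? : Decidable Solves
    P? x = (H (x + a) + H x) ≟ b
    solution : ∀ {x} → Solves x → x ∈ filter P? elements
    solution {x} = ∈-filter⁺ P? (elements-complete x)
    satisfies : ∀ {x} → x ∈ filter P? elements → Solves x
    satisfies m = proj₂ (∈-filter⁻ P? {xs = elements} m)

    length≤2⇒two : #sols H a b ≤ 2 → AtMostTwo Solves
    length≤2⇒two length≤2 sx sy sz = length≤2⇒atMostTwo length≤2 (solution sx) (solution sy) (solution sz)

    two⇒length≤2 : AtMostTwo Solves → #sols H a b ≤ 2
    two⇒length≤2 two = atMostTwo⇒length≤2 (filter⁺ P? elements-unique) (λ mx my mz → two (satisfies mx) (satisfies my) (satisfies mz))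

  B≡derivative+const : ∀ H x a → B H x a ≡ (H (x + a) + H x) + (H a + H 0#)
  B≡derivative+const H x a = +-assoc (H (x + a) + H x) (H a) (H 0#)

  B-sym : ∀ H x t → B H x t ≡ B H t x
  B-sym H x t = cong (_+ H 0#) (begin
    H (x + t) + H x + H t   ≡⟨ cong (λ z → H z + H x + H t) (+-comm x t) ⟩
    H (t + x) + H x + H t   ≡⟨ xy∙z≈xz∙y (H (t + x)) (H x) (H t) ⟩
    H (t + x) + H t + H x   ∎)

  B-self : ∀ H a → B H a a ≡ 0#
  B-self H a = begin
    H (a + a) + H a + H a + H 0#     ≡⟨ cong (_+ H 0#) (+-assoc (H (a + a)) (H a) (H a)) ⟩
    H (a + a) + (H a + H a) + H 0#   ≡⟨ cong₂ (λ u v → H u + v + H 0#) (x+x≡0 a) (x+x≡0 (H a)) ⟩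
    H 0# + 0# + H 0#                 ≡⟨ cong (_+ H 0#) (+-identityʳ (H 0#)) ⟩
    H 0# + H 0#                      ≡⟨ x+x≡0 (H 0#) ⟩
    0#                               ∎

  HasMinimalKernels : (Carrier → Carrier) → Set
  HasMinimalKernels H = ∀ a z → a ≢ 0# → B H z a ≡ 0# → z ≡ 0# ⊎ z ≡ a

  APN⇒minimalKernels : ∀ {H} → IsAPN H → HasMinimalKernels H
  APN⇒minimalKernels {H} H-APN a z a≢0 Bza≡0 =
    [ (λ 0≡a → ⊥-elim (a≢0 (sym 0≡a))) , Sum.map sym sym ]′
      (Equivalence.to (#sols≤2⇔atMostTwo H a (H a + H 0#)) (H-APN a _ a≢0) sol-0 sol-a sol-z)
    where
    sol-0 : H (0# + a) + H 0# ≡ H a + H 0#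
    sol-0 = cong (λ u → H u + H 0#) (+-identityˡ a)
    sol-a : H (a + a) + H a ≡ H a + H 0#
    sol-a = trans (cong (λ u → H u + H a) (x+x≡0 a)) (+-comm (H 0#) (H a))
    sol-z : H (z + a) + H z ≡ H a + H 0#
    sol-z = x+y≡0⇒x≡y (trans (sym (B≡derivative+const H z a)) Bza≡0)

  minimalKernels⇒APN : ∀ {H} → (∀ x y t → B H (x + y) t ≡ B H x t + B H y t) →
                       HasMinimalKernels H → IsAPN H
  minimalKernels⇒APN {H} B-additive kernels a b a≢0 = Equivalence.from (#sols≤2⇔atMostTwo H a b) two
    where
    c : Carrier
    c = H a + H 0#
    B-sum-of-solutions : ∀ {u v} → H (u + a) + H u ≡ b → H (v + a) + H v ≡ b → B H (u + v) a ≡ 0#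
    B-sum-of-solutions {u} {v} su sv = begin
      B H (u + v) a                                     ≡⟨ B-additive u v a ⟩
      B H u a + B H v a                                 ≡⟨ cong₂ _+_ (B≡derivative+const H u a) (B≡derivative+const H v a) ⟩
      (H (u + a) + H u + c) + (H (v + a) + H v + c)     ≡⟨ cong₂ (λ p r → (p + c) + (r + c)) su sv ⟩
      (b + c) + (b + c)                                 ≡⟨ x+x≡0 (b + c) ⟩
      0#                                                ∎
    two : AtMostTwo (λ x → H (x + a) + H x ≡ b)
    two {x} {y} {z} sx sy sz
      with kernels a (x + y) a≢0 (B-sum-of-solutions sx sy) | kernels a (x + z) a≢0 (B-sum-of-solutions sx sz)
    ... | inj₁ x+y≡0 | _           = inj₁ (x+y≡0⇒x≡y x+y≡0)
    ... | _          | inj₁ x+z≡0  = inj₂ (inj₁ (x+y≡0⇒x≡y x+z≡0))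
    ... | inj₂ x+y≡a | inj₂ x+z≡a  = inj₂ (inj₂ (x+y≡x+z⇒y≡z (trans x+y≡a (sym x+z≡a))))

  additiveˡ⇒quadratic : ∀ {H} → (∀ x y t → B H (x + y) t ≡ B H x t + B H y t) → IsQuadratic H
  additiveˡ⇒quadratic {H} additiveˡ = additiveˡ , additiveʳ
    where
    additiveʳ : ∀ x t s → B H x (t + s) ≡ B H x t + B H x s
    additiveʳ x t s = begin
      B H x (t + s)       ≡⟨ B-sym H x (t + s) ⟩
      B H (t + s) x       ≡⟨ additiveˡ t s x ⟩
      B H t x + B H s x   ≡⟨ cong₂ _+_ (B-sym H t x) (B-sym H s x) ⟩
      B H x t + B H x s   ∎

  +-linear : ∀ {f g} → IsLinear f → IsLinear g → IsLinear (λ z → f z + g z)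
  +-linear {f} {g} f-linear g-linear x y = begin
    f (x + y) + g (x + y)       ≡⟨ cong₂ _+_ (f-linear x y) (g-linear x y) ⟩
    (f x + f y) + (g x + g y)   ≡⟨ interchange (f x) (f y) (g x) (g y) ⟩
    (f x + g x) + (f y + g y)   ∎

  B-+ : ∀ f g x t → B (λ z → f z + g z) x t ≡ B f x t + B g x t
  B-+ f g x t = begin
    (f (x + t) + g (x + t)) + (f x + g x) + (f t + g t) + (f 0# + g 0#)
      ≡⟨ cong (λ u → u + (f t + g t) + (f 0# + g 0#)) (interchange (f (x + t)) (g (x + t)) (f x) (g x)) ⟩
    (f (x + t) + f x) + (g (x + t) + g x) + (f t + g t) + (f 0# + g 0#)
      ≡⟨ cong (_+ (f 0# + g 0#)) (interchange (f (x + t) + f x) (g (x + t) + g x) (f t) (g t)) ⟩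
    (f (x + t) + f x + f t) + (g (x + t) + g x + g t) + (f 0# + g 0#)
      ≡⟨ interchange (f (x + t) + f x + f t) (g (x + t) + g x + g t) (f 0#) (g 0#) ⟩
    B f x t + B g x t
      ∎

  +-quadratic : ∀ {f g} → IsQuadratic f → IsQuadratic g → IsQuadratic (λ z → f z + g z)
  +-quadratic {f} {g} (f-additiveˡ , _) (g-additiveˡ , _) = additiveˡ⇒quadratic λ x y t → begin
    B (λ z → f z + g z) (x + y) t                   ≡⟨ B-+ f g (x + y) t ⟩
    B f (x + y) t + B g (x + y) t                   ≡⟨ cong₂ _+_ (f-additiveˡ x y t) (g-additiveˡ x y t) ⟩
    (B f x t + B f y t) + (B g x t + B g y t)       ≡⟨ interchange (B f x t) (B f y t) (B g x t) (B g y t) ⟩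
    (B f x t + B g x t) + (B f y t + B g y t)       ≡⟨ cong₂ _+_ (B-+ f g x t) (B-+ f g y t) ⟨
    B (λ z → f z + g z) x t + B (λ z → f z + g z) y t ∎

  B-* : ∀ {f g} → IsLinear f → IsLinear g → ∀ x t → B (λ z → f z * g z) x t ≡ f x * g t + f t * g x
  B-* {f} {g} f-linear g-linear x t = begin
    f (x + t) * g (x + t) + f x * g x + f t * g t + f 0# * g 0#
      ≡⟨ cong₂ (λ u v → u + f x * g x + f t * g t + v * g 0#)
               (cong₂ _*_ (f-linear x t) (g-linear x t)) (linear⇒0↦0 f-linear) ⟩
    (f x + f t) * (g x + g t) + f x * g x + f t * g t + 0# * g 0#
      ≡⟨ trans (cong (_ +_) (zeroˡ (g 0#))) (+-identityʳ _) ⟩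
    (f x + f t) * (g x + g t) + f x * g x + f t * g t
      ≡⟨ cong (λ u → u + f x * g x + f t * g t)
              (trans (distribʳ (g x + g t) (f x) (f t)) (cong₂ _+_ (distribˡ (f x) (g x) (g t)) (distribˡ (f t) (g x) (g t)))) ⟩
    ((A + P) + (Q + D)) + A + D
      ≡⟨ +-assoc ((A + P) + (Q + D)) A D ⟩
    ((A + P) + (Q + D)) + (A + D)
      ≡⟨ cong (λ u → ((A + P) + u) + (A + D)) (+-comm Q D) ⟩
    ((A + P) + (D + Q)) + (A + D)
      ≡⟨ cong (_+ (A + D)) (interchange A P D Q) ⟩
    ((A + D) + (P + Q)) + (A + D)
      ≡⟨ +-comm ((A + D) + (P + Q)) (A + D) ⟩
    (A + D) + ((A + D) + (P + Q))
      ≡⟨ x+[x+y]≡y (A + D) (P + Q) ⟩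
    P + Q
      ∎
    where
    A P Q D : Carrier
    A = f x * g x
    P = f x * g t
    Q = f t * g x
    D = f t * g t

  *-quadratic : ∀ {f g} → IsLinear f → IsLinear g → IsQuadratic (λ z → f z * g z)
  *-quadratic {f} {g} f-linear g-linear = additiveˡ⇒quadratic λ x y t → begin
    B fg (x + y) t                                      ≡⟨ B-* f-linear g-linear (x + y) t ⟩
    f (x + y) * g t + f t * g (x + y)                   ≡⟨ cong₂ (λ u v → u * g t + f t * v) (f-linear x y) (g-linear x y) ⟩
    (f x + f y) * g t + f t * (g x + g y)               ≡⟨ cong₂ _+_ (distribʳ (g t) (f x) (f y)) (distribˡ (f t) (g x) (g y)) ⟩
    (f x * g t + f y * g t) + (f t * g x + f t * g y)   ≡⟨ interchange (f x * g t) (f y * g t) (f t * g x) (f t * g y) ⟩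
    (f x * g t + f t * g x) + (f y * g t + f t * g y)   ≡⟨ cong₂ _+_ (B-* f-linear g-linear x t) (B-* f-linear g-linear y t) ⟨
    B fg x t + B fg y t                                 ∎
    where
    fg : Carrier → Carrier
    fg z = f z * g z

  InjectiveOnT₀ : (Carrier → Carrier) → Set
  InjectiveOnT₀ f = ∀ x y → Tr x ≡ 0# → Tr y ≡ 0# → f x ≡ f y → x ≡ y

  module Switching {F L : Carrier → Carrier} (F-quadratic : IsQuadratic F) (L-linear : IsLinear L) where

    G : Carrier → Carrier
    G = switch F L

    switch-quadratic : IsQuadratic G
    switch-quadratic = +-quadratic F-quadratic (*-quadratic Tr-linear L-linear)

    B-switch : ∀ x t → B G x t ≡ B F x t + (Tr x * L t + Tr t * L x)
    B-switch x t = trans (B-+ F (λ z → Tr z * L z) x t) (cong (B F x t +_) (B-* Tr-linear L-linear x t))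

    B-switch-T₀ : ∀ {x t} → Tr x ≡ 0# → B G x t ≡ B F x t + Tr t * L x
    B-switch-T₀ {x} {t} Tr-x = begin
      B G x t                                   ≡⟨ B-switch x t ⟩
      B F x t + (Tr x * L t + Tr t * L x)       ≡⟨ cong (λ u → B F x t + (u * L t + Tr t * L x)) Tr-x ⟩
      B F x t + (0# * L t + Tr t * L x)         ≡⟨ cong (λ u → B F x t + (u + Tr t * L x)) (zeroˡ (L t)) ⟩
      B F x t + (0# + Tr t * L x)               ≡⟨ cong (B F x t +_) (+-identityˡ (Tr t * L x)) ⟩
      B F x t + Tr t * L x                      ∎

    B-switch-T₀T₀ : ∀ {x t} → Tr x ≡ 0# → Tr t ≡ 0# → B G x t ≡ B F x t
    B-switch-T₀T₀ {x} {t} Tr-x Tr-t = begin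
      B G x t                 ≡⟨ B-switch-T₀ Tr-x ⟩
      B F x t + Tr t * L x    ≡⟨ cong (λ u → B F x t + u * L x) Tr-t ⟩
      B F x t + 0# * L x      ≡⟨ cong (B F x t +_) (zeroˡ (L x)) ⟩
      B F x t + 0#            ≡⟨ +-identityʳ (B F x t) ⟩
      B F x t                 ∎

    B-switch-T₀T₁ : ∀ {x t} → Tr x ≡ 0# → Tr t ≡ 1# → B G x t ≡ L x + B F x t
    B-switch-T₀T₁ {x} {t} Tr-x Tr-t = begin
      B G x t                 ≡⟨ B-switch-T₀ Tr-x ⟩
      B F x t + Tr t * L x    ≡⟨ cong (λ u → B F x t + u * L x) Tr-t ⟩
      B F x t + 1# * L x      ≡⟨ cong (B F x t +_) (*-identityˡ (L x)) ⟩
      B F x t + L x           ≡⟨ +-comm (B F x t) (L x) ⟩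
      L x + B F x t           ∎

    La-linear : ∀ e0 a → IsLinear (La F L e0 a)
    La-linear e0 a = +-linear L-linear (λ x y → proj₁ F-quadratic x y (a + e0))

    switch-APN⇒La-injective : ∀ {e0} → Tr e0 ≡ 1# → IsAPN G → ∀ a → Tr a ≡ 0# → InjectiveOnT₀ (La F L e0 a)
    switch-APN⇒La-injective {e0} Tr-e0 G-APN a Tr-a x y Tr-x Tr-y Lₐx≡Lₐy =
      [ x+y≡0⇒x≡y , (λ x+y≡c → ⊥-elim (T₀≢T₁ Tr-x+y Tr-c x+y≡c)) ]′
        (APN⇒minimalKernels G-APN c (x + y) (T₀≢T₁ Tr-0 Tr-c ∘ sym) B-x+y-c≡0)
      where
      Lₐ : Carrier → Carrier
      Lₐ = La F L e0 a
      c : Carrier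
      c = a + e0
      Tr-c : Tr c ≡ 1#
      Tr-c = trans (Tr-+ Tr-a Tr-e0) (+-identityˡ 1#)
      Tr-x+y : Tr (x + y) ≡ 0#
      Tr-x+y = trans (Tr-+ Tr-x Tr-y) (+-identityˡ 0#)
      B-x+y-c≡0 : B G (x + y) c ≡ 0#
      B-x+y-c≡0 = begin
        B G (x + y) c   ≡⟨ B-switch-T₀T₁ Tr-x+y Tr-c ⟩
        Lₐ (x + y)      ≡⟨ La-linear e0 a x y ⟩
        Lₐ x + Lₐ y     ≡⟨ cong (_+ Lₐ y) Lₐx≡Lₐy ⟩
        Lₐ y + Lₐ y     ≡⟨ x+x≡0 (Lₐ y) ⟩
        0#              ∎

    La-injective⇒switch-APN : ∀ {e0} → Tr e0 ≡ 1# → IsAPN F →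
                              (∀ a → Tr a ≡ 0# → InjectiveOnT₀ (La F L e0 a)) → IsAPN G
    La-injective⇒switch-APN {e0} Tr-e0 F-APN La-injective =
      minimalKernels⇒APN (proj₁ switch-quadratic) kernels
      where
      kernel-T₀ : ∀ {c w} → Tr c ≡ 1# → Tr w ≡ 0# → B G w c ≡ 0# → w ≡ 0#
      kernel-T₀ {c} {w} Tr-c Tr-w Bwc≡0 = La-injective a (trans (Tr-+ Tr-c Tr-e0) char2) w 0# Tr-w Tr-0 (begin
        Lₐ w                      ≡⟨ cong (λ u → L w + B F w u) (x+y+y≡x c e0) ⟩
        L w + B F w c             ≡⟨ B-switch-T₀T₁ Tr-w Tr-c ⟨
        B G w c                   ≡⟨ Bwc≡0 ⟩
        0#                        ≡⟨ linear⇒0↦0 (La-linear e0 a) ⟨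
        Lₐ 0#                     ∎)
        where
        a : Carrier
        a = c + e0
        Lₐ : Carrier → Carrier
        Lₐ = La F L e0 a

      kernels : HasMinimalKernels G
      kernels c z c≢0 Bzc≡0 with Tr≡0⊎Tr≡1 c | Tr≡0⊎Tr≡1 z
      ... | inj₁ Tr-c | inj₁ Tr-z = APN⇒minimalKernels F-APN c z c≢0 (trans (sym (B-switch-T₀T₀ Tr-z Tr-c)) Bzc≡0)
      ... | inj₂ Tr-c | inj₁ Tr-z = inj₁ (kernel-T₀ Tr-c Tr-z Bzc≡0)
      ... | inj₁ Tr-c | inj₂ Tr-z = ⊥-elim (c≢0 (kernel-T₀ Tr-z Tr-c (trans (B-sym G c z) Bzc≡0)))
      ... | inj₂ Tr-c | inj₂ Tr-z = inj₂ (x+y≡0⇒x≡y (kernel-T₀ Tr-c (trans (Tr-+ Tr-z Tr-c) char2) (begin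
        B G (z + c) c             ≡⟨ proj₁ switch-quadratic z c c ⟩
        B G z c + B G c c         ≡⟨ cong₂ _+_ Bzc≡0 (B-self G c) ⟩
        0# + 0#                   ≡⟨ +-identityˡ 0# ⟩
        0#                        ∎)))

theorem2 : {n : ℕ} (K : GF2^ n) →
    let open GF2^ K in
    (F L : Carrier → Carrier) → IsQuadratic F → IsAPN F → IsLinear L →
    (e0 : Carrier) → Tr e0 ≡ 1# →
    ((IsQuadratic (switch F L) × IsAPN (switch F L)) ⇔
     (∀ a → Tr a ≡ 0# → ∀ x y → Tr x ≡ 0# → Tr y ≡ 0# →
        La F L e0 a x ≡ La F L e0 a y → x ≡ y))
theorem2 K F L F-quadratic F-APN L-linear e0 Tr-e0 = mk⇔
  (λ (_ , G-APN) → switch-APN⇒La-injective Tr-e0 G-APN)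
  (λ La-injective → switch-quadratic , La-injective⇒switch-APN Tr-e0 F-APN La-injective)
  where open Switching K F-quadratic L-linear
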